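{- Let $f(x,y,z)=5x^2+5y^2+8z^2-4xz-3xy$ and $g(x,y,z)=5x^2+7y^2+7z^2+6yz+xz+5xy$. Then $Q(f)=Q(g)$, i.e., for every nonnegative integer $n$, the equation $f(x,y,z)=n$ has a solution $(x,y,z)\in\mathbb{Z}^3$ if and only if the equation $g(x,y,z)=n$ has a solution $(x,y,z)\in\mathbb{Z}^3$.
   Context: For a positive definite ternary quadratic form $h$ with integer coefficients, $Q(h)$ denotes the set of all nonnegative integers $n$ such that $h(x,y,z)=n$ has an integer solution $(x,y,z)\in\mathbb{Z}^3$. -}

module Defs where

open import Data.Integer using (ℤ; +_; _+_; _-_; _*_)
open import Data.Nat using (ℕ)
open import Data.Product using (∃-syntax; _×_)
open import Relation.Binary.PropositionalEquality using (_≡_)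

Form : Set
Form = ℤ → ℤ → ℤ → ℤ

InQ : Form → ℕ → Set
InQ h n = ∃[ x ] ∃[ y ] ∃[ z ] (h x y z ≡ + n)

f : Form
f x y z = + 5 * (x * x) + + 5 * (y * y) + + 8 * (z * z) - + 4 * (x * z) - + 3 * (x * y)

g : Form
g x y z = + 5 * (x * x) + + 7 * (y * y) + + 7 * (z * z) + + 6 * (y * z) + x * z + + 5 * (x * y)

-- f and g are rationally equivalent up to scaling: there are integer matrices M and
-- denominators D ∣ 18 with g(M v) = D² f(v) (and vice versa).  Whenever D divides every
-- entry of M v, the integer vector M v / D represents f(v) by g.  Divisibility of M v by D
-- depends only on v modulo 18, and a finite search shows that each of the 18³ residue
-- classes is handled by one of eight such matrices, in each direction.
module Submission where

open import Defs
open import Data.Nat as ℕ using (ℕ; _<_)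
open import Data.Nat.Properties using (allUpTo?)
open import Data.Integer using (ℤ; +_; -_; _+_; _-_; _*_; NonZero)
open import Data.Integer.Properties using (*-cancelˡ-≡; i*j≢0)
open import Data.Integer.DivMod using (_/_; _%_; a≡a%n+[a/n]*n; n%d<d)
open import Data.Integer.Divisibility.Signed using (_∣_; divides; _∣?_; ∣m∣n⇒∣m+n; ∣n⇒∣m*n)
open import Data.Integer.Tactic.RingSolver using (solve-∀)
open import Data.List using (List; []; _∷_)
open import Data.List.Relation.Unary.Any using (Any; any?; satisfied)
open import Data.Product using (Σ; _×_; _,_)
open import Data.Unit using (tt)
open import Function using (_∘_)
open import Relation.Nullary.Decidable using (Dec; _×-dec_; toWitness)
open import Relation.Binary.PropositionalEquality using (_≡_; refl; sym; trans; cong; cong₂; subst; module ≡-Reasoning)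

ℤ³ : Set
ℤ³ = ℤ × ℤ × ℤ

_$³_ : Form → ℤ³ → ℤ
h $³ (x , y , z) = h x y z

InQ-resp : ∀ {h h′ : Form} → (∀ x y z → h x y z ≡ h′ x y z) → ∀ {n} → InQ h n → InQ h′ n
InQ-resp h≗h′ (x , y , z , hxyz≡n) = x , y , z , subst (_≡ _) (h≗h′ x y z) hxyz≡n

record QuadraticForm : Set where
  constructor quadratic
  field a b c r s t : ℤ

⟦_⟧ : QuadraticForm → Form
⟦ quadratic a b c r s t ⟧ x y z =
  a * (x * x) + b * (y * y) + c * (z * z) + r * (y * z) + s * (x * z) + t * (x * y)

polar : QuadraticForm → ℤ³ → ℤ³ → ℤ
polar (quadratic a b c r s t) (x , y , z) (x′ , y′ , z′) =
  + 2 * a * (x * x′) + + 2 * b * (y * y′) + + 2 * c * (z * z′)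
  + r * (y * z′ + z * y′) + s * (x * z′ + z * x′) + t * (x * y′ + y * x′)

scale : ℤ → QuadraticForm → QuadraticForm
scale k (quadratic a b c r s t) = quadratic (k * a) (k * b) (k * c) (k * r) (k * s) (k * t)

⟦scale⟧ : ∀ k q x y z → ⟦ scale k q ⟧ x y z ≡ k * ⟦ q ⟧ x y z
⟦scale⟧ k (quadratic a b c r s t) = linear-in-coefficients k a b c r s t
  where
  linear-in-coefficients : ∀ k a b c r s t x y z →
    let Q : ℤ → ℤ → ℤ → ℤ → ℤ → ℤ → ℤ
        Q a b c r s t = a * (x * x) + b * (y * y) + c * (z * z) + r * (y * z) + s * (x * z) + t * (x * y)
    in Q (k * a) (k * b) (k * c) (k * r) (k * s) (k * t) ≡ k * Q a b c r s t
  linear-in-coefficients = solve-∀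

⟦⟧-homogeneous : ∀ q k x y z → ⟦ q ⟧ (x * k) (y * k) (z * k) ≡ (k * k) * ⟦ q ⟧ x y z
⟦⟧-homogeneous (quadratic a b c r s t) = quadratic-in-variables a b c r s t
  where
  quadratic-in-variables : ∀ a b c r s t k x y z →
    let q : ℤ → ℤ → ℤ → ℤ
        q X Y Z = a * (X * X) + b * (Y * Y) + c * (Z * Z) + r * (Y * Z) + s * (X * Z) + t * (X * Y)
    in q (x * k) (y * k) (z * k) ≡ (k * k) * q x y z
  quadratic-in-variables = solve-∀

record Matrix : Set where
  constructor columns
  field col₁ col₂ col₃ : ℤ³

_·_ : Matrix → ℤ³ → ℤ³
columns (u₁ , u₂ , u₃) (v₁ , v₂ , v₃) (w₁ , w₂ , w₃) · (x , y , z) =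
  x * u₁ + y * v₁ + z * w₁ , x * u₂ + y * v₂ + z * w₂ , x * u₃ + y * v₃ + z * w₃

-- q ∘ M, whose Gram matrix is Mᵀ A M.
pullback : QuadraticForm → Matrix → QuadraticForm
pullback q (columns u v w) =
  quadratic (⟦ q ⟧ $³ u) (⟦ q ⟧ $³ v) (⟦ q ⟧ $³ w) (polar q v w) (polar q u w) (polar q u v)

⟦pullback⟧ : ∀ q M v → ⟦ pullback q M ⟧ $³ v ≡ ⟦ q ⟧ $³ (M · v)
⟦pullback⟧ (quadratic a b c r s t) (columns (u₁ , u₂ , u₃) (v₁ , v₂ , v₃) (w₁ , w₂ , w₃)) (x , y , z) =
  sym (gram a b c r s t u₁ u₂ u₃ v₁ v₂ v₃ w₁ w₂ w₃ x y z)
  where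
  gram : ∀ a b c r s t u₁ u₂ u₃ v₁ v₂ v₃ w₁ w₂ w₃ x y z →
    let q : ℤ → ℤ → ℤ → ℤ
        q X Y Z = a * (X * X) + b * (Y * Y) + c * (Z * Z) + r * (Y * Z) + s * (X * Z) + t * (X * Y)
        β : ℤ → ℤ → ℤ → ℤ → ℤ → ℤ → ℤ
        β X Y Z X′ Y′ Z′ = + 2 * a * (X * X′) + + 2 * b * (Y * Y′) + + 2 * c * (Z * Z′)
                         + r * (Y * Z′ + Z * Y′) + s * (X * Z′ + Z * X′) + t * (X * Y′ + Y * X′)
    in q (x * u₁ + y * v₁ + z * w₁) (x * u₂ + y * v₂ + z * w₂) (x * u₃ + y * v₃ + z * w₃)
       ≡ q u₁ u₂ u₃ * (x * x) + q v₁ v₂ v₃ * (y * y) + q w₁ w₂ w₃ * (z * z)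
         + β v₁ v₂ v₃ w₁ w₂ w₃ * (y * z) + β u₁ u₂ u₃ w₁ w₂ w₃ * (x * z) + β u₁ u₂ u₃ v₁ v₂ v₃ * (x * y)
  gram = solve-∀

_∣³_ : ℤ → ℤ³ → Set
d ∣³ (x , y , z) = d ∣ x × d ∣ y × d ∣ z

_∣³?_ : ∀ d v → Dec (d ∣³ v)
d ∣³? (x , y , z) = d ∣? x ×-dec d ∣? y ×-dec d ∣? z

∣-linear-periodic : ∀ {d} α β γ x y z a b c N → d ∣ N → d ∣ x * α + y * β + z * γ →
          d ∣ (x + a * N) * α + (y + b * N) * β + (z + c * N) * γ
∣-linear-periodic α β γ x y z a b c N d∣N d∣ℓ =
  subst (_ ∣_) (sym (shift α β γ x y z a b c N))
    (∣m∣n⇒∣m+n d∣ℓ (∣n⇒∣m*n (a * α + b * β + c * γ) d∣N))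
  where
  shift : ∀ α β γ x y z a b c N → (x + a * N) * α + (y + b * N) * β + (z + c * N) * γ
                                  ≡ (x * α + y * β + z * γ) + (a * α + b * β + c * γ) * N
  shift = solve-∀

∣³-·-periodic : ∀ {d} M x y z a b c N → d ∣ N → d ∣³ (M · (x , y , z)) →
                d ∣³ (M · (x + a * N , y + b * N , z + c * N))
∣³-·-periodic (columns (u₁ , u₂ , u₃) (v₁ , v₂ , v₃) (w₁ , w₂ , w₃)) x y z a b c N d∣N (d∣₁ , d∣₂ , d∣₃) =
  ∣-linear-periodic u₁ v₁ w₁ x y z a b c N d∣N d∣₁ ,
  ∣-linear-periodic u₂ v₂ w₂ x y z a b c N d∣N d∣₂ ,
  ∣-linear-periodic u₃ v₃ w₃ x y z a b c N d∣N d∣₃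

record RationalRepresentation (p q : QuadraticForm) : Set where
  constructor representation
  field
    denominator : ℤ
    {{denominator-nonZero}} : NonZero denominator
    matrix : Matrix
    pullback≡scaled : pullback q matrix ≡ scale (denominator * denominator) p

open RationalRepresentation

IntegralAt : ∀ {p q} → RationalRepresentation p q → ℤ³ → Set
IntegralAt ρ v = denominator ρ ∣³ (matrix ρ · v)

represent : ∀ {p q} (ρ : RationalRepresentation p q) v → IntegralAt ρ v →
            Σ ℤ³ λ w → ⟦ q ⟧ $³ w ≡ ⟦ p ⟧ $³ v
represent {p} {q} (representation D M q∘M≡D²p) v@(x , y , z) (divides k₁ e₁ , divides k₂ e₂ , divides k₃ e₃) =
  (k₁ , k₂ , k₃) , *-cancelˡ-≡ (D * D) _ _ D²q[k]≡D²p[v]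
  where
  instance _ = i*j≢0 D D
  open ≡-Reasoning
  D²q[k]≡D²p[v] : (D * D) * ⟦ q ⟧ k₁ k₂ k₃ ≡ (D * D) * ⟦ p ⟧ x y z
  D²q[k]≡D²p[v] = begin
    (D * D) * ⟦ q ⟧ k₁ k₂ k₃            ≡⟨ sym (⟦⟧-homogeneous q D k₁ k₂ k₃) ⟩
    ⟦ q ⟧ (k₁ * D) (k₂ * D) (k₃ * D)   ≡⟨ sym (cong₂ (λ X YZ → ⟦ q ⟧ $³ (X , YZ)) e₁ (cong₂ _,_ e₂ e₃)) ⟩
    ⟦ q ⟧ $³ (M · v)                   ≡⟨ sym (⟦pullback⟧ q M v) ⟩
    ⟦ pullback q M ⟧ $³ v              ≡⟨ cong (λ r → ⟦ r ⟧ $³ v) q∘M≡D²p ⟩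
    ⟦ scale (D * D) p ⟧ x y z          ≡⟨ ⟦scale⟧ (D * D) p x y z ⟩
    (D * D) * ⟦ p ⟧ x y z              ∎

FitsModulo : ∀ {p q} → ℕ → ℤ³ → RationalRepresentation p q → Set
FitsModulo N v ρ = denominator ρ ∣ + N × IntegralAt ρ v

fitsModulo? : ∀ {p q} N v (ρ : RationalRepresentation p q) → Dec (FitsModulo N v ρ)
fitsModulo? N v ρ = denominator ρ ∣? + N ×-dec denominator ρ ∣³? (matrix ρ · v)

Covers : ∀ {p q} → ℕ → List (RationalRepresentation p q) → Set
Covers N ρs = ∀ {i} → i < N → ∀ {j} → j < N → ∀ {k} → k < N → Any (FitsModulo N (+ i , + j , + k)) ρs

covers? : ∀ {p q} N (ρs : List (RationalRepresentation p q)) → Dec (Covers N ρs)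
covers? N ρs =
  allUpTo? (λ i → allUpTo? (λ j → allUpTo? (λ k → any? (fitsModulo? N (+ i , + j , + k)) ρs) N) N) N

integralAt-residues⇒integralAt : ∀ {p q} (ρ : RationalRepresentation p q) N .{{_ : ℕ.NonZero N}} x y z →
  denominator ρ ∣ + N → IntegralAt ρ (+ (x % + N) , + (y % + N) , + (z % + N)) → IntegralAt ρ (x , y , z)
integralAt-residues⇒integralAt ρ N x y z D∣N integral =
  subst (IntegralAt ρ) (sym v≡residues+quotients*N)
    (∣³-·-periodic (matrix ρ) (+ (x % + N)) (+ (y % + N)) (+ (z % + N))
                   (x / + N) (y / + N) (z / + N) (+ N) D∣N integral)
  where
  v≡residues+quotients*N : (x , y , z) ≡ (+ (x % + N) + (x / + N) * + N ,
                                          + (y % + N) + (y / + N) * + N ,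
                                          + (z % + N) + (z / + N) * + N)
  v≡residues+quotients*N =
    cong₂ _,_ (a≡a%n+[a/n]*n x (+ N)) (cong₂ _,_ (a≡a%n+[a/n]*n y (+ N)) (a≡a%n+[a/n]*n z (+ N)))

Covers⇒InQ-⊆ : ∀ {p q} N .{{_ : ℕ.NonZero N}} (ρs : List (RationalRepresentation p q)) → Covers N ρs →
      ∀ {n} → InQ ⟦ p ⟧ n → InQ ⟦ q ⟧ n
Covers⇒InQ-⊆ {p} {q} N ρs covered {n} (x , y , z , p[v]≡n) =
  viaResidueClass (satisfied (covered (n%d<d x (+ N)) (n%d<d y (+ N)) (n%d<d z (+ N))))
  where
  fromRepresentation : Σ ℤ³ (λ w → ⟦ q ⟧ $³ w ≡ ⟦ p ⟧ x y z) → InQ ⟦ q ⟧ n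
  fromRepresentation ((x′ , y′ , z′) , q[w]≡p[v]) = x′ , y′ , z′ , trans q[w]≡p[v] p[v]≡n
  viaResidueClass : Σ (RationalRepresentation p q) (FitsModulo N (+ (x % + N) , + (y % + N) , + (z % + N))) →
                    InQ ⟦ q ⟧ n
  viaResidueClass (ρ , D∣N , integral) =
    fromRepresentation (represent ρ (x , y , z) (integralAt-residues⇒integralAt ρ N x y z D∣N integral))

form-f : QuadraticForm
form-f = quadratic (+ 5) (+ 5) (+ 8) (+ 0) (- + 4) (- + 3)

form-g : QuadraticForm
form-g = quadratic (+ 5) (+ 7) (+ 7) (+ 6) (+ 1) (+ 5)

f≗⟦form-f⟧ : ∀ x y z → f x y z ≡ ⟦ form-f ⟧ x y z
f≗⟦form-f⟧ = normalise
  where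
  normalise : ∀ x y z → + 5 * (x * x) + + 5 * (y * y) + + 8 * (z * z) - + 4 * (x * z) - + 3 * (x * y)
                        ≡ + 5 * (x * x) + + 5 * (y * y) + + 8 * (z * z) + + 0 * (y * z) + - + 4 * (x * z) + - + 3 * (x * y)
  normalise = solve-∀

g≗⟦form-g⟧ : ∀ x y z → g x y z ≡ ⟦ form-g ⟧ x y z
g≗⟦form-g⟧ = normalise
  where
  normalise : ∀ x y z → + 5 * (x * x) + + 7 * (y * y) + + 7 * (z * z) + + 6 * (y * z) + x * z + + 5 * (x * y)
                        ≡ + 5 * (x * x) + + 7 * (y * y) + + 7 * (z * z) + + 6 * (y * z) + + 1 * (x * z) + + 5 * (x * y)
  normalise = solve-∀

f-by-g : List (RationalRepresentation form-f form-g)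
f-by-g =
    representation (+ 2) (columns (- + 2 , + 0 , + 0) (+ 0 , + 1 , + 1) (+ 0 , + 2 , - + 2)) refl
  ∷ representation (+ 2) (columns (- + 2 , + 1 , - + 1) (+ 0 , + 1 , + 1) (+ 0 , - + 2 , + 2)) refl
  ∷ representation (+ 3) (columns (- + 3 , + 0 , + 0) (+ 2 , - + 2 , - + 1) (+ 0 , + 3 , - + 3)) refl
  ∷ representation (+ 3) (columns (- + 1 , - + 2 , + 2) (+ 1 , - + 1 , - + 2) (+ 4 , - + 1 , + 1)) refl
  ∷ representation (+ 6) (columns (- + 2 , + 5 , - + 5) (- + 2 , + 2 , + 4) (+ 8 , - + 2 , + 2)) refl
  ∷ representation (+ 9) (columns (- + 10 , + 4 , - + 1) (+ 3 , + 6 , - + 6) (+ 4 , - + 7 , - + 5)) refl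
  ∷ representation (+ 9) (columns (- + 1 , - + 5 , + 8) (+ 9 , + 0 , + 0) (+ 4 , - + 7 , - + 5)) refl
  ∷ representation (+ 18) (columns (- + 16 , + 1 , - + 7) (+ 6 , + 12 , - + 12) (- + 8 , + 14 , + 10)) refl
  ∷ []

g-by-f : List (RationalRepresentation form-g form-f)
g-by-f =
    representation (+ 2) (columns (- + 2 , + 0 , + 0) (+ 0 , + 2 , + 1) (+ 0 , + 2 , - + 1)) refl
  ∷ representation (+ 2) (columns (- + 2 , + 0 , - + 1) (+ 0 , + 2 , - + 1) (+ 0 , + 2 , + 1)) refl
  ∷ representation (+ 3) (columns (- + 3 , + 0 , + 0) (- + 2 , - + 3 , + 1) (- + 2 , - + 3 , - + 2)) refl
  ∷ representation (+ 3) (columns (- + 1 , + 0 , + 2) (- + 3 , - + 3 , + 0) (+ 1 , - + 3 , + 1)) refl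
  ∷ representation (+ 6) (columns (- + 2 , + 0 , - + 5) (- + 2 , + 6 , - + 2) (+ 6 , + 6 , + 0)) refl
  ∷ representation (+ 9) (columns (- + 8 , + 3 , - + 2) (- + 1 , + 6 , - + 7) (- + 5 , - + 6 , - + 8)) refl
  ∷ representation (+ 9) (columns (- + 1 , - + 3 , - + 7) (- + 11 , - + 6 , - + 5) (- + 7 , + 6 , - + 4)) refl
  ∷ representation (+ 18) (columns (- + 20 , - + 6 , - + 5) (- + 10 , - + 12 , - + 16) (- + 2 , + 12 , - + 14)) refl
  ∷ []

mainTheorem4 : (n : ℕ) → (InQ f n → InQ g n) × (InQ g n → InQ f n)
mainTheorem4 n = Q[f]⊆Q[g] , Q[g]⊆Q[f]
  where
  Q[f]⊆Q[g] : InQ f n → InQ g n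
  Q[f]⊆Q[g] = InQ-resp (λ x y z → sym (g≗⟦form-g⟧ x y z))
            ∘ Covers⇒InQ-⊆ 18 f-by-g (toWitness {a? = covers? 18 f-by-g} tt)
            ∘ InQ-resp f≗⟦form-f⟧
  Q[g]⊆Q[f] : InQ g n → InQ f n
  Q[g]⊆Q[f] = InQ-resp (λ x y z → sym (f≗⟦form-f⟧ x y z))
            ∘ Covers⇒InQ-⊆ 18 g-by-f (toWitness {a? = covers? 18 g-by-f} tt)
            ∘ InQ-resp g≗⟦form-g⟧
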